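{- Let $G$ be a finite simple graph. Then $G$ admits a link-irregular labeling if and only if for all distinct $x,y\in V(G)$, either $L(x)\not\cong L(y)$ (as unlabeled graphs) or $E(L(x))\neq E(L(y))$.
   Context: All graphs are finite and simple. For a vertex $v$ of a graph $G$, its link is $L(v)=G[N(v)]$, the subgraph induced by the (open) neighborhood $N(v)$. An edge-labeling of $G$ is a map $l:E(G)\to\mathbb{Z}^+$. The labeled link $L_l(v)$ is $L(v)$ with each edge carrying its label under $l$. Two labeled graphs are isomorphic if there is a graph isomorphism between them preserving edge labels. The labeling $l$ is link-irregular if $L_l(u)\not\cong L_l(v)$ for all distinct $u,v\in V(G)$. -}

module Defs where

open import Data.Nat using (ℕ; _<_)
open import Data.Bool using (Bool; false; _∧_; T)
open import Data.Fin using (Fin)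
open import Data.Product using (Σ; ∃; _×_; proj₁)
open import Relation.Binary.PropositionalEquality using (_≡_; _≢_)
open import Relation.Nullary using (¬_)
open import Function.Bundles using (_⤖_; Bijection)

record Graph (n : ℕ) : Set where
  field
    adj    : Fin n → Fin n → Bool
    sym    : ∀ u v → adj u v ≡ adj v u
    irrefl : ∀ v → adj v v ≡ false
open Graph public

Nbhd : ∀ {n} → Graph n → Fin n → Set
Nbhd {n} G v = Σ (Fin n) (λ w → T (adj G v w))

-- An isomorphism of (unlabeled) links L(u) ≅ L(v): a bijection
-- N(u) → N(v) preserving and reflecting adjacency (L(v) is induced).
record LinkIso {n} (G : Graph n) (u v : Fin n) : Set where
  field
    bij      : Nbhd G u ⤖ Nbhd G v
    adj-pres : ∀ (a b : Nbhd G u) →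
               adj G (proj₁ a) (proj₁ b)
                 ≡ adj G (proj₁ (Bijection.to bij a)) (proj₁ (Bijection.to bij b))

-- An edge-labeling l : E(G) → ℤ⁺, represented by a symmetric function on
-- pairs of vertices that is positive on edges (values on non-edges are
-- irrelevant).
record Labeling {n} (G : Graph n) : Set where
  field
    lab     : Fin n → Fin n → ℕ
    lab-sym : ∀ u v → lab u v ≡ lab v u
    lab-pos : ∀ u v → T (adj G u v) → 0 < lab u v
open Labeling public

record LabeledLinkIso {n} (G : Graph n) (l : Labeling G) (u v : Fin n) : Set where
  field
    iso        : LinkIso G u v
  open LinkIso iso
  field
    label-pres : ∀ (a b : Nbhd G u) → T (adj G (proj₁ a) (proj₁ b)) →
                 lab l (proj₁ a) (proj₁ b)
                   ≡ lab l (proj₁ (Bijection.to bij a)) (proj₁ (Bijection.to bij b))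

LinkIrregular : ∀ {n} (G : Graph n) → Labeling G → Set
LinkIrregular {n} G l = ∀ (u v : Fin n) → u ≢ v → ¬ LabeledLinkIso G l u v

linkEdge : ∀ {n} → Graph n → Fin n → Fin n → Fin n → Bool
linkEdge G x a b = adj G x a ∧ adj G x b ∧ adj G a b

SameLinkEdges : ∀ {n} → Graph n → Fin n → Fin n → Set
SameLinkEdges {n} G x y = ∀ (a b : Fin n) → linkEdge G x a b ≡ linkEdge G y a b

{-# OPTIONS --safe #-}
-- If L(x) ≅ L(y) and E(L(x)) = E(L(y)), the two links have the same non-isolated
-- vertices and the same edges, and a link isomorphism maps isolated vertices onto
-- isolated vertices. Patching it to be the identity on the non-isolated vertices
-- therefore gives an isomorphism of L(x) and L(y) preserving every labeling, so no
-- labeling distinguishes x from y. Conversely, take a labeling injective on edges: a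
-- labeled isomorphism L_l(x) ≅ L_l(y) sends each edge {a,b} of L(x) to the edge of
-- L(y) with the same label, which is {a,b} itself, hence E(L(x)) = E(L(y)).
module Submission where

open import Defs hiding (sym)
open import Data.Nat using (ℕ; suc; s≤s; z≤n)
open import Data.Nat.Properties using (suc-injective)
open import Data.Fin using (Fin; toℕ; combine; _≤?_)
open import Data.Fin.Properties using (toℕ-injective; combine-injective; ≤-antisym; ≤-total; any?; all?)
open import Data.Bool using (Bool; true; false; T)
open import Data.Bool.Properties using (T?; T-irrelevant; T-∧) renaming (_≟_ to _≟ᵇ_)
open import Data.Empty using (⊥-elim)
open import Data.Product using (Σ; ∃; _×_; _,_; proj₁; proj₂; uncurry; swap)
open import Data.Product.Properties using (Σ-≡,≡→≡; ×-≡,≡→≡; ×-≡,≡←≡)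
open import Data.Sum using (_⊎_; inj₁; inj₂; [_,_])
open import Function using (_∘_)
open import Function.Bundles using (Bijection; Inverse; Equivalence; mk↔ₛ′)
open import Function.Properties.Bijection using (⤖⇒↔)
open import Function.Properties.Inverse using (↔⇒⤖; ↔-sym)
open import Relation.Nullary using (¬_; Dec; yes; no)
open import Relation.Nullary.Decidable using (toSum)
open import Relation.Binary.PropositionalEquality
  using (_≡_; _≢_; refl; sym; trans; cong; cong₂; subst; module ≡-Reasoning)

T-injective : ∀ {a b} → (T a → T b) → (T b → T a) → a ≡ b
T-injective {false} {false} _ _ = refl
T-injective {false} {true}  _ g = ⊥-elim (g _)
T-injective {true}  {false} f _ = ⊥-elim (f _)
T-injective {true}  {true}  _ _ = refl

sortPair : ∀ {n} → Fin n → Fin n → Fin n × Fin n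
sortPair a b with a ≤? b
... | yes _ = a , b
... | no  _ = b , a

sortPair-comm : ∀ {n} (a b : Fin n) → sortPair a b ≡ sortPair b a
sortPair-comm a b with a ≤? b | b ≤? a
... | yes a≤b | yes b≤a = cong₂ _,_ (≤-antisym a≤b b≤a) (≤-antisym b≤a a≤b)
... | yes _   | no  _   = refl
... | no  _   | yes _   = refl
... | no  a≰b | no  b≰a = ⊥-elim ([ a≰b , b≰a ] (≤-total a b))

sortPair-cases : ∀ {n} (a b : Fin n) → sortPair a b ≡ (a , b) ⊎ sortPair a b ≡ (b , a)
sortPair-cases a b with a ≤? b
... | yes _ = inj₁ refl
... | no  _ = inj₂ refl

sortPair-injective : ∀ {n} {a b c d : Fin n} → sortPair a b ≡ sortPair c d →
                     (a ≡ c × b ≡ d) ⊎ (a ≡ d × b ≡ c)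
sortPair-injective {a = a} {b} {c} {d} e with sortPair-cases a b | sortPair-cases c d
... | inj₁ p | inj₁ q = inj₁ (×-≡,≡←≡ (trans (sym p) (trans e q)))
... | inj₁ p | inj₂ q = inj₂ (×-≡,≡←≡ (trans (sym p) (trans e q)))
... | inj₂ p | inj₁ q = inj₂ (swap (×-≡,≡←≡ (trans (sym p) (trans e q))))
... | inj₂ p | inj₂ q = inj₁ (swap (×-≡,≡←≡ (trans (sym p) (trans e q))))

pairCode : ∀ {n} → Fin n → Fin n → ℕ
pairCode a b = toℕ (uncurry combine (sortPair a b))

pairCode-injective : ∀ {n} {a b c d : Fin n} → pairCode a b ≡ pairCode c d →
                     (a ≡ c × b ≡ d) ⊎ (a ≡ d × b ≡ c)
pairCode-injective {a = a} {b} {c} {d} e = sortPair-injective (×-≡,≡→≡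
  (combine-injective (proj₁ (sortPair a b)) (proj₂ (sortPair a b))
                     (proj₁ (sortPair c d)) (proj₂ (sortPair c d)) (toℕ-injective e)))

module _ {n} {G : Graph n} where

  adjᴺ : ∀ {x y} → Nbhd G x → Nbhd G y → Bool
  adjᴺ a b = adj G (proj₁ a) (proj₁ b)

  labᴺ : Labeling G → ∀ {x y} → Nbhd G x → Nbhd G y → ℕ
  labᴺ l a b = lab l (proj₁ a) (proj₁ b)

  nbhd-≡ : ∀ {x} {a b : Nbhd G x} → proj₁ a ≡ proj₁ b → a ≡ b
  nbhd-≡ e = Σ-≡,≡→≡ (e , T-irrelevant _ _)

  linkEdge⁺ : ∀ {x a b} → T (adj G x a) → T (adj G x b) → T (adj G a b) → T (linkEdge G x a b)
  linkEdge⁺ xa xb ab = Equivalence.from T-∧ (xa , Equivalence.from T-∧ (xb , ab))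

  linkEdge⁻ : ∀ {x a b} → T (linkEdge G x a b) → T (adj G x a) × T (adj G x b) × T (adj G a b)
  linkEdge⁻ e with Equivalence.to T-∧ e
  ... | xa , e′ = xa , Equivalence.to T-∧ e′

  sameLinkEdges? : ∀ x y → Dec (SameLinkEdges G x y)
  sameLinkEdges? x y = all? λ a → all? λ b → linkEdge G x a b ≟ᵇ linkEdge G y a b

  sameLinkEdges-sym : ∀ {x y} → SameLinkEdges G x y → SameLinkEdges G y x
  sameLinkEdges-sym same a b = sym (same a b)

  NonIsolated : Fin n → Fin n → Set
  NonIsolated x a = ∃ λ b → T (linkEdge G x a b)

  nonIsolated? : ∀ x a → Dec (NonIsolated x a)
  nonIsolated? x a = any? λ b → T? (linkEdge G x a b)

  nonIsolated⇒adj : ∀ {x a} → NonIsolated x a → T (adj G x a)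
  nonIsolated⇒adj (_ , e) = proj₁ (linkEdge⁻ e)

  adj⇒nonIsolated : ∀ {x} (a b : Nbhd G x) → T (adjᴺ a b) → NonIsolated x (proj₁ a)
  adj⇒nonIsolated a b ab = proj₁ b , linkEdge⁺ (proj₂ a) (proj₂ b) ab

  nonIsolated-transport : ∀ {x y a} → SameLinkEdges G x y → NonIsolated x a → NonIsolated y a
  nonIsolated-transport {a = a} same (b , e) = b , subst T (same a b) e

  linkMap : ∀ {x y} → LinkIso G x y → Nbhd G x → Nbhd G y
  linkMap iso = Bijection.to (LinkIso.bij iso)

  linkIso-sym : ∀ {x y} → LinkIso G x y → LinkIso G y x
  linkIso-sym {y = y} iso = record { bij = ↔⇒⤖ (↔-sym φ) ; adj-pres = adj-pres⁻ }
    where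
    open LinkIso iso
    φ = ⤖⇒↔ bij
    open Inverse φ using (from; strictlyInverseˡ)
    adj-pres⁻ : ∀ (c d : Nbhd G y) → adjᴺ c d ≡ adjᴺ (from c) (from d)
    adj-pres⁻ c d = begin
      adjᴺ c d                                           ≡⟨ cong₂ adjᴺ (strictlyInverseˡ c) (strictlyInverseˡ d) ⟨
      adjᴺ (linkMap iso (from c)) (linkMap iso (from d)) ≡⟨ adj-pres (from c) (from d) ⟨
      adjᴺ (from c) (from d)                             ∎
      where open ≡-Reasoning

  linkIso-sym-inverseˡ : ∀ {x y} (iso : LinkIso G x y) c → linkMap iso (linkMap (linkIso-sym iso) c) ≡ c
  linkIso-sym-inverseˡ iso = Inverse.strictlyInverseˡ (⤖⇒↔ (LinkIso.bij iso))

  linkIso-sym-inverseʳ : ∀ {x y} (iso : LinkIso G x y) a → linkMap (linkIso-sym iso) (linkMap iso a) ≡ a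
  linkIso-sym-inverseʳ iso = Inverse.strictlyInverseʳ (⤖⇒↔ (LinkIso.bij iso))

  linkMap-nonIsolated : ∀ {x y} (iso : LinkIso G x y) (a : Nbhd G x) →
                        NonIsolated x (proj₁ a) → NonIsolated y (proj₁ (linkMap iso a))
  linkMap-nonIsolated iso a (b , e) with linkEdge⁻ e
  ... | _ , xb , ab = adj⇒nonIsolated (linkMap iso a) (linkMap iso (b , xb))
                        (subst T (LinkIso.adj-pres iso a (b , xb)) ab)

  linkMap-isolated : ∀ {x y} (iso : LinkIso G x y) (a : Nbhd G x) →
                     ¬ NonIsolated x (proj₁ a) → ¬ NonIsolated y (proj₁ (linkMap iso a))
  linkMap-isolated iso a isolated c = isolated
    (subst (NonIsolated _ ∘ proj₁) (linkIso-sym-inverseʳ iso a)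
           (linkMap-nonIsolated (linkIso-sym iso) (linkMap iso a) c))

  module _ {x y} (iso : LinkIso G x y) (same : SameLinkEdges G x y) where

    patch : Nbhd G x → Nbhd G y
    patch (a , xa) with nonIsolated? x a
    ... | yes c = a , nonIsolated⇒adj (nonIsolated-transport same c)
    ... | no  _ = linkMap iso (a , xa)

    patch-nonIsolated : ∀ {a} → NonIsolated x (proj₁ a) → proj₁ (patch a) ≡ proj₁ a
    patch-nonIsolated {a , _} c with nonIsolated? x a
    ... | yes _ = refl
    ... | no  i = ⊥-elim (i c)

    patch-isolated : ∀ {a} → ¬ NonIsolated x (proj₁ a) → patch a ≡ linkMap iso a
    patch-isolated {a , _} i with nonIsolated? x a
    ... | yes c = ⊥-elim (i c)
    ... | no  _ = refl

    patch-preserves-nonIsolated : ∀ {a} → NonIsolated x (proj₁ a) → NonIsolated y (proj₁ (patch a))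
    patch-preserves-nonIsolated c =
      subst (NonIsolated y) (sym (patch-nonIsolated c)) (nonIsolated-transport same c)

    patch-preserves-isolated : ∀ {a} → ¬ NonIsolated x (proj₁ a) → ¬ NonIsolated y (proj₁ (patch a))
    patch-preserves-isolated {a} i =
      subst (λ b → ¬ NonIsolated y (proj₁ b)) (sym (patch-isolated i)) (linkMap-isolated iso a i)

    patch-adj-isolated : ∀ {a} b → ¬ NonIsolated x (proj₁ a) → adjᴺ a b ≡ adjᴺ (patch a) (patch b)
    patch-adj-isolated {a} b i = T-injective
      (⊥-elim ∘ i ∘ adj⇒nonIsolated a b)
      (⊥-elim ∘ patch-preserves-isolated i ∘ adj⇒nonIsolated (patch a) (patch b))

    -- Splitting on toSum rather than on the decision itself keeps the goal's
    -- occurrences of patch folded, so the computation lemmas above apply.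
    patch-adj : ∀ a b → adjᴺ a b ≡ adjᴺ (patch a) (patch b)
    patch-adj a b with toSum (nonIsolated? x (proj₁ a)) | toSum (nonIsolated? x (proj₁ b))
    ... | inj₁ ca | inj₁ cb = sym (cong₂ (adj G) (patch-nonIsolated ca) (patch-nonIsolated cb))
    ... | inj₂ ia | _       = patch-adj-isolated b ia
    ... | inj₁ _  | inj₂ ib = begin
      adjᴺ a b                 ≡⟨ Graph.sym G _ _ ⟩
      adjᴺ b a                 ≡⟨ patch-adj-isolated a ib ⟩
      adjᴺ (patch b) (patch a) ≡⟨ Graph.sym G _ _ ⟩
      adjᴺ (patch a) (patch b) ∎
      where open ≡-Reasoning

    patch-lab : ∀ l a b → T (adjᴺ a b) → labᴺ l a b ≡ labᴺ l (patch a) (patch b)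
    patch-lab l a b ab = sym (cong₂ (lab l)
      (patch-nonIsolated (adj⇒nonIsolated a b ab))
      (patch-nonIsolated (adj⇒nonIsolated b a (subst T (Graph.sym G _ _) ab))))

  patch-inverse : ∀ {x y} (iso : LinkIso G x y) (iso⁻ : LinkIso G y x) →
                  (∀ a → linkMap iso⁻ (linkMap iso a) ≡ a) →
                  (same : SameLinkEdges G x y) (same⁻ : SameLinkEdges G y x) →
                  ∀ a → patch iso⁻ same⁻ (patch iso same a) ≡ a
  patch-inverse {x} iso iso⁻ inverse same same⁻ a with toSum (nonIsolated? x (proj₁ a))
  ... | inj₁ c = nbhd-≡ (begin
    proj₁ (patch iso⁻ same⁻ (patch iso same a)) ≡⟨ patch-nonIsolated iso⁻ same⁻ (patch-preserves-nonIsolated iso same c) ⟩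
    proj₁ (patch iso same a)                    ≡⟨ patch-nonIsolated iso same c ⟩
    proj₁ a                                     ∎)
    where open ≡-Reasoning
  ... | inj₂ i = begin
    patch iso⁻ same⁻ (patch iso same a) ≡⟨ cong (patch iso⁻ same⁻) (patch-isolated iso same i) ⟩
    patch iso⁻ same⁻ (linkMap iso a)    ≡⟨ patch-isolated iso⁻ same⁻ (linkMap-isolated iso a i) ⟩
    linkMap iso⁻ (linkMap iso a)        ≡⟨ inverse a ⟩
    a                                   ∎
    where open ≡-Reasoning

  sameLinkEdges⇒labeledLinkIso : ∀ {x y} → LinkIso G x y → SameLinkEdges G x y →
                                 (l : Labeling G) → LabeledLinkIso G l x y
  sameLinkEdges⇒labeledLinkIso iso same l = record
    { iso        = record { bij = patchBijection ; adj-pres = patch-adj iso same }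
    ; label-pres = patch-lab iso same l
    }
    where
    iso⁻  = linkIso-sym iso
    same⁻ = sameLinkEdges-sym same
    patchBijection = ↔⇒⤖ (mk↔ₛ′ (patch iso same) (patch iso⁻ same⁻)
      (patch-inverse iso⁻ iso (linkIso-sym-inverseˡ iso) same⁻ same)
      (patch-inverse iso iso⁻ (linkIso-sym-inverseʳ iso) same same⁻))

  InjectiveOnEdges : Labeling G → Set
  InjectiveOnEdges l = ∀ {a b c d} → T (adj G a b) → T (adj G c d) →
                       lab l a b ≡ lab l c d → (a ≡ c × b ≡ d) ⊎ (a ≡ d × b ≡ c)

  pairLabeling : Labeling G
  pairLabeling = record
    { lab     = λ a b → suc (pairCode a b)
    ; lab-sym = λ a b → cong suc (cong (toℕ ∘ uncurry combine) (sortPair-comm a b))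
    ; lab-pos = λ _ _ _ → s≤s z≤n
    }

  pairLabeling-injectiveOnEdges : InjectiveOnEdges pairLabeling
  pairLabeling-injectiveOnEdges _ _ = pairCode-injective ∘ suc-injective

  labeledLinkIso-sym : ∀ {l x y} → LabeledLinkIso G l x y → LabeledLinkIso G l y x
  labeledLinkIso-sym {l} {y = y} liso = record { iso = iso⁻ ; label-pres = label-pres⁻ }
    where
    open LabeledLinkIso liso
    iso⁻ = linkIso-sym iso
    φ  = linkMap iso
    φ⁻ = linkMap iso⁻
    label-pres⁻ : ∀ (c d : Nbhd G y) → T (adjᴺ c d) → labᴺ l c d ≡ labᴺ l (φ⁻ c) (φ⁻ d)
    label-pres⁻ c d cd = begin
      labᴺ l c d                   ≡⟨ cong₂ (labᴺ l) (linkIso-sym-inverseˡ iso c) (linkIso-sym-inverseˡ iso d) ⟨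
      labᴺ l (φ (φ⁻ c)) (φ (φ⁻ d)) ≡⟨ label-pres (φ⁻ c) (φ⁻ d) (subst T (LinkIso.adj-pres iso⁻ c d) cd) ⟨
      labᴺ l (φ⁻ c) (φ⁻ d)         ∎
      where open ≡-Reasoning

  linkEdge-transport : ∀ {l x y} → InjectiveOnEdges l → LabeledLinkIso G l x y →
                       ∀ {a b} → T (linkEdge G x a b) → T (linkEdge G y a b)
  linkEdge-transport {y = y} injective liso {a} {b} e with linkEdge⁻ e
  ... | xa , xb , ab =
    [ (λ (a≡a′ , b≡b′) → linkEdge⁺ (∈Nbhd a′ a≡a′) (∈Nbhd b′ b≡b′) ab)
    , (λ (a≡b′ , b≡a′) → linkEdge⁺ (∈Nbhd b′ a≡b′) (∈Nbhd a′ b≡a′) ab)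
    ] (injective ab a′b′ (label-pres (a , xa) (b , xb) ab))
    where
    open LabeledLinkIso liso
    a′ = linkMap iso (a , xa)
    b′ = linkMap iso (b , xb)
    a′b′ : T (adjᴺ a′ b′)
    a′b′ = subst T (LinkIso.adj-pres iso (a , xa) (b , xb)) ab
    ∈Nbhd : ∀ {v} (c : Nbhd G y) → v ≡ proj₁ c → T (adj G y v)
    ∈Nbhd c v≡c = subst (T ∘ adj G y) (sym v≡c) (proj₂ c)

  injectiveOnEdges⇒sameLinkEdges : ∀ {l x y} → InjectiveOnEdges l → LabeledLinkIso G l x y →
                                   SameLinkEdges G x y
  injectiveOnEdges⇒sameLinkEdges injective liso a b = T-injective
    (linkEdge-transport injective liso)
    (linkEdge-transport injective (labeledLinkIso-sym liso))

mainTheorem1 : ∀ (n : ℕ) (G : Graph n) →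
    (Σ (Labeling G) (λ l → LinkIrregular G l)
      → ∀ (x y : Fin n) → x ≢ y → ¬ LinkIso G x y ⊎ ¬ SameLinkEdges G x y)
    × ((∀ (x y : Fin n) → x ≢ y → ¬ LinkIso G x y ⊎ ¬ SameLinkEdges G x y)
      → Σ (Labeling G) (λ l → LinkIrregular G l))
mainTheorem1 n G = necessary , sufficient
  where
  necessary : Σ (Labeling G) (LinkIrregular G) →
              ∀ x y → x ≢ y → ¬ LinkIso G x y ⊎ ¬ SameLinkEdges G x y
  necessary (l , irregular) x y x≢y with sameLinkEdges? {G = G} x y
  ... | yes same = inj₁ λ iso → irregular x y x≢y (sameLinkEdges⇒labeledLinkIso iso same l)
  ... | no ¬same = inj₂ ¬same

  sufficient : (∀ x y → x ≢ y → ¬ LinkIso G x y ⊎ ¬ SameLinkEdges G x y) →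
               Σ (Labeling G) (LinkIrregular G)
  sufficient separated = pairLabeling , λ x y x≢y liso →
    [ (λ ¬iso → ¬iso (LabeledLinkIso.iso liso))
    , (λ ¬same → ¬same (injectiveOnEdges⇒sameLinkEdges (pairLabeling-injectiveOnEdges {G = G}) liso))
    ] (separated x y x≢y)
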